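{- Let $v$ be an $(a-c,b-d)$-bispecial factor of $\mathbf u_\beta$. Then $f_L(a,b)=0^tm$ if $\{a,b\}=\{m-1,m+p-1\}$ and $f_L(a,b)=\epsilon$ otherwise, and $f_R(c,d)=0^{\min\{t_{c\oplus1},t_{d\oplus1}\}}$. Moreover, the $f$-image $f(v)$ is an $(a'-c',b'-d')$-bispecial factor, where $c'$ and $d'$ are the first letters of the words $0^{t_{c\oplus1}-\min\{t_{c\oplus1},t_{d\oplus1}\}}(c\oplus1)$ and $0^{t_{d\oplus1}-\min\{t_{c\oplus1},t_{d\oplus1}\}}(d\oplus1)$ respectively, and $a',b'$ are $0$ and $z$ (in some order) if $\{a,b\}=\{m-1,m+p-1\}$, while $a'=a\oplus1$ and $b'=b\oplus1$ otherwise.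
   Context: Let $\beta>1$ be a non-simple Parry number: its Rényi expansion of unity $d_\beta(1)=t_1t_2t_3\cdots$ (nonnegative integers with $t_1=\lfloor\beta\rfloor$, $1=\sum_{i\ge1}t_i\beta^{ -i}$, and $t_it_{i+1}\cdots\prec t_1t_2\cdots$ lexicographically for all $i\ge2$) has the form $t_1\cdots t_m(t_{m+1}\cdots t_{m+p})^\omega$ and is not of the form $t_1\cdots t_k0^\omega$, with $m,p\ge1$ least possible (so $t_m\neq t_{m+p}$). Assume $t_1\ge2$. On $\mathcal A=\{0,1,\dots,m+p-1\}$ let $\varphi$ be the substitution $\varphi(k)=0^{t_{k+1}}(k+1)$ for $0\le k\le m+p-2$, $\varphi(m+p-1)=0^{t_{m+p}}m$, and $\mathbf u_\beta=\lim_n\varphi^n(0)$ its fixed point. For $k,\ell\in\mathbb N$, $k\oplus\ell$ is the letter $k+\ell$ if $k+\ell<m+p$ and $m+((k+\ell-m)\bmod p)$ otherwise; for $k+\ell>0$, $t_{k\oplus\ell}$ denotes $t_{k+\ell}$ if $k+\ell\le m+p$ and $t_{m+1+((k+\ell-m-1)\bmod p)}$ otherwise. Let $t=\min\{t_m,t_{m+p}\}$ and let $z$ be the unique nonzero letter such that $z0^tm$ is a factor of $\mathbf u_\beta$. For letters $a\ne b$, $c\ne d$, a factor $v$ is an $(a-c,b-d)$-bispecial factor if $avc$ and $bvd$ are both factors of $\mathbf u_\beta$. For distinct letters $x,y$, $f_L(x,y)$ is the longest common suffix and $f_R(x,y)$ the longest common prefix of $\varphi(x)$ and $\varphi(y)$.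 The $f$-image of an $(a-c,b-d)$-bispecial factor $v$ is $f(v)=f_L(a,b)\varphi(v)f_R(c,d)$. -}

module Defs where

open import Data.Nat using (ℕ; zero; suc; _+_; _∸_; _≤_; _<_; _≥_; _>_; _⊓_)
open import Data.Nat.DivMod using (_%_)
open import Data.Nat.Properties using (_≟_; _<?_; _≤?_)
open import Data.List using (List; []; _∷_; _++_; replicate; concatMap; reverse; [_])
open import Data.Product using (Σ; ∃; _×_; _,_)
open import Data.Empty using (⊥)
import Data.Sum
open import Relation.Nullary using (¬_; yes; no)
open import Relation.Binary.PropositionalEquality using (_≡_; _≢_)

-- The digit sequence d_β(1) = t₁ t₂ t₃ ⋯ is a function t : ℕ → ℕ,
-- indexed from 1 (the value t 0 is never used).

ShiftLexLess : (ℕ → ℕ) → ℕ → Set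
ShiftLexLess t i =
  Σ ℕ λ n → (∀ j → j < n → t (i + suc j) ≡ t (suc j)) × t (i + suc n) < t (suc n)

EventuallyPeriodic : (ℕ → ℕ) → ℕ → ℕ → Set
EventuallyPeriodic t m' p' = ∀ i → i > m' → t (i + p') ≡ t i

-- Standing hypotheses: t is the Rényi expansion of unity d_β(1) of a non-simple
-- Parry number β > 1 (via Parry's characterisation: the admissibility condition
-- t_i t_{i+1} ⋯ ≺ t₁ t₂ ⋯ for all i ≥ 2), of the form t₁⋯t_m (t_{m+1}⋯t_{m+p})^ω
-- with m, p ≥ 1 least possible, not of the form t₁⋯t_k 0^ω.
record NonSimpleParry (m p : ℕ) (t : ℕ → ℕ) : Set where
  field
    m≥1        : m ≥ 1
    p≥1        : p ≥ 1
    t₁≥1       : t 1 ≥ 1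
    admissible : ∀ i → i ≥ 1 → ShiftLexLess t i
    periodic   : EventuallyPeriodic t m p
    minimal    : ∀ m' p' → m' ≥ 1 → p' ≥ 1 → EventuallyPeriodic t m' p' → m ≤ m' × p ≤ p'
    nonSimple  : ¬ (Σ ℕ λ k → ∀ i → i > k → t i ≡ 0)

-- n mod p (p ≥ 1 in all uses)
_mod_ : ℕ → ℕ → ℕ
n mod zero    = n
n mod (suc q) = n % suc q

Word : Set
Word = List ℕ

module Setup (m p : ℕ) (t : ℕ → ℕ) where

  φ : ℕ → Word
  φ k with suc k <? m + p
  ... | yes _ = replicate (t (suc k)) 0 ++ [ suc k ]
  ... | no  _ = replicate (t (m + p)) 0 ++ [ m ]

  φ* : Word → Word
  φ* = concatMap φ

  iter : ℕ → Word → Word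
  iter zero    w = w
  iter (suc n) w = φ* (iter n w)

  uPrefix : ℕ → Word
  uPrefix n = iter n [ 0 ]

  -- w is a factor of u_β = lim φⁿ(0)
  Factor : Word → Set
  Factor w = Σ ℕ λ n → Σ Word λ x → Σ Word λ y → x ++ w ++ y ≡ uPrefix n

  _⊕_ : ℕ → ℕ → ℕ
  k ⊕ ℓ with k + ℓ <? m + p
  ... | yes _ = k + ℓ
  ... | no  _ = m + ((k + ℓ ∸ m) mod p)

  -- t_{k⊕ℓ}  (for k + ℓ > 0)
  t⊕ : ℕ → ℕ → ℕ
  t⊕ k ℓ with k + ℓ ≤? m + p
  ... | yes _ = t (k + ℓ)
  ... | no  _ = t (m + 1 + ((k + ℓ ∸ m ∸ 1) mod p))

  tmin : ℕ
  tmin = t m ⊓ t (m + p)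

  lcp : Word → Word → Word
  lcp (x ∷ xs) (y ∷ ys) with x ≟ y
  ... | yes _ = x ∷ lcp xs ys
  ... | no  _ = []
  lcp _ _ = []

  lcs : Word → Word → Word
  lcs u w = reverse (lcp (reverse u) (reverse w))

  fL : ℕ → ℕ → Word
  fL x y = lcs (φ x) (φ y)

  fR : ℕ → ℕ → Word
  fR x y = lcp (φ x) (φ y)

  Bispecial : ℕ → ℕ → ℕ → ℕ → Word → Set
  Bispecial a c b d v =
    a ≢ b × c ≢ d × Factor (a ∷ v ++ [ c ]) × Factor (b ∷ v ++ [ d ])

  fImage : ℕ → ℕ → ℕ → ℕ → Word → Word
  fImage a c b d v = fL a b ++ φ* v ++ fR c d

  -- first letter of a word (default 0 for the empty word; only used on nonempty words)
  firstLetter : Word → ℕ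
  firstLetter []      = 0
  firstLetter (x ∷ _) = x

  SpecialPair : ℕ → ℕ → Set
  SpecialPair a b = (a ≡ m ∸ 1 × b ≡ m + p ∸ 1) Data.Sum.⊎ (a ≡ m + p ∸ 1 × b ≡ m ∸ 1)

-- Every letter a of the alphabet has image φ a = 0^{t_{a⊕1}} (a⊕1), and a ⊕ 1 determines a except
-- for {m-1, m+p-1}, the two letters whose images end in m; as t_m ≠ t_{m+p} (minimality of m and p),
-- φ is nevertheless injective. This computes f_L and f_R. Applying φ to occurrences of avc and bvd,
-- the new right extensions are the letters after the common prefix 0^μ of φ c and φ d, and the new
-- left extension is the last letter of φ a, i.e. a ⊕ 1, except in the special case: there the letter
-- with the longer image gives 0, and for the one whose image is exactly 0^t m one looks a letter
-- further left, at a letter l whose image ends in l ⊕ 1, which therefore precedes 0^t m and equals z.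

module Submission where

open import Defs
open import Data.Nat using (ℕ; zero; suc; _+_; _∸_; _<_; _≤_; _≥_; _⊓_; z≤n; s≤s)
open import Data.Nat.Properties
open import Data.Nat.DivMod using (n%n≡0)
open import Data.List using (List; []; _∷_; _++_; replicate; [_]; reverse; _∷ʳ_)
open import Data.List.Properties using (++-assoc; ++-monoid; reverse-++; unfold-reverse; concatMap-++; ∷-injectiveˡ)
open import Data.List.Reverse using (reverseView; []; _∶_∶ʳ_)
open import Data.List.Relation.Unary.All using (All; []; _∷_)
open import Data.List.Relation.Unary.All.Properties using (++⁺; ++⁻ˡ; ++⁻ʳ; replicate⁺; concat⁺; gmap⁺)
open import Data.Product as Product using (∃; _×_; _,_; proj₁; proj₂; map₂)
open import Data.Sum as Sum using (_⊎_; inj₁; inj₂)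
open import Data.Empty using (⊥-elim)
open import Relation.Nullary using (¬_; yes; no)
open import Relation.Binary.Definitions using (tri<; tri≈; tri>)
open import Relation.Binary.PropositionalEquality hiding ([_])
open import Function using (_∘_)
open import Tactic.MonoidSolver using (solve)

0^_ : ℕ → Word
0^ k = replicate k 0

0^-+-snoc : ∀ j k e → 0^ (j + k) ++ [ e ] ≡ 0^ j ++ 0^ k ++ [ e ]
0^-+-snoc zero    k e = refl
0^-+-snoc (suc j) k e = cong (0 ∷_) (0^-+-snoc j k e)

reverse-0^ : ∀ k → reverse (0^ k) ≡ 0^ k
reverse-0^ zero    = refl
reverse-0^ (suc k) = begin
  reverse (0 ∷ 0^ k)  ≡⟨ unfold-reverse 0 (0^ k) ⟩
  reverse (0^ k) ∷ʳ 0 ≡⟨ cong (_∷ʳ 0) (reverse-0^ k) ⟩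
  0^ k ∷ʳ 0           ≡⟨ ∷ʳ-0 k ⟩
  0 ∷ 0^ k            ∎
  where
  open ≡-Reasoning
  ∷ʳ-0 : ∀ k → 0^ k ∷ʳ 0 ≡ 0 ∷ 0^ k
  ∷ʳ-0 zero    = refl
  ∷ʳ-0 (suc k) = cong (0 ∷_) (∷ʳ-0 k)

mod-self : ∀ n → n mod n ≡ 0
mod-self zero    = refl
mod-self (suc n) = n%n≡0 (suc n)

ShiftLexLess⇒≤ : ∀ {t i} → ShiftLexLess t i → t (i + 1) ≤ t 1
ShiftLexLess⇒≤ (zero  , _     , lt) = <⇒≤ lt
ShiftLexLess⇒≤ (suc n , agree , _)  = ≤-reflexive (agree 0 (s≤s z≤n))

periodic⇒¬ShiftLexLess : ∀ {t i} → (∀ j → t (i + suc j) ≡ t (suc j)) → ¬ ShiftLexLess t i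
periodic⇒¬ShiftLexLess shift≡t (n , _ , lt) = <-irrefl (shift≡t n) lt

module Bispecials (m p : ℕ) (t : ℕ → ℕ) where
  open Setup m p t

  0^-snoc-split : ∀ k x e → k ≤ x →
    ∃ λ R → 0^ x ++ [ e ] ≡ 0^ k ++ firstLetter (0^ (x ∸ k) ++ [ e ]) ∷ R
  0^-snoc-split zero    zero    e _         = [] , refl
  0^-snoc-split zero    (suc x) e _         = 0^ x ++ [ e ] , refl
  0^-snoc-split (suc k) (suc x) e (s≤s k≤x) = map₂ (cong (0 ∷_)) (0^-snoc-split k x e k≤x)

  firstLetter-0^-∸⊓-≢ : ∀ x y {e f} → e ≢ 0 → f ≢ 0 → (x ≡ y → e ≢ f) →
    firstLetter (0^ (x ∸ x ⊓ y) ++ [ e ]) ≢ firstLetter (0^ (y ∸ x ⊓ y) ++ [ f ])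
  firstLetter-0^-∸⊓-≢ zero    zero    e≢0 f≢0 h = h refl
  firstLetter-0^-∸⊓-≢ zero    (suc y) e≢0 f≢0 h = e≢0
  firstLetter-0^-∸⊓-≢ (suc x) zero    e≢0 f≢0 h = ≢-sym f≢0
  firstLetter-0^-∸⊓-≢ (suc x) (suc y) e≢0 f≢0 h = firstLetter-0^-∸⊓-≢ x y e≢0 f≢0 (h ∘ cong suc)

  lcp-∷-≡ : ∀ e xs ys → lcp (e ∷ xs) (e ∷ ys) ≡ e ∷ lcp xs ys
  lcp-∷-≡ e xs ys with e ≟ e
  ... | yes _   = refl
  ... | no  e≢e = ⊥-elim (e≢e refl)

  lcp-∷-≢ : ∀ {e f} xs ys → e ≢ f → lcp (e ∷ xs) (f ∷ ys) ≡ []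
  lcp-∷-≢ {e} {f} xs ys e≢f with e ≟ f
  ... | yes e≡f = ⊥-elim (e≢f e≡f)
  ... | no  _   = refl

  lcp-0^ : ∀ x y → lcp (0^ x) (0^ y) ≡ 0^ (x ⊓ y)
  lcp-0^ zero    y       = refl
  lcp-0^ (suc x) zero    = refl
  lcp-0^ (suc x) (suc y) = trans (lcp-∷-≡ 0 (0^ x) (0^ y)) (cong (0 ∷_) (lcp-0^ x y))

  lcp-0^-snoc : ∀ x y {e f} → e ≢ 0 → f ≢ 0 → (x ≡ y → e ≢ f) →
    lcp (0^ x ++ [ e ]) (0^ y ++ [ f ]) ≡ 0^ (x ⊓ y)
  lcp-0^-snoc zero    zero    e≢0 f≢0 h = lcp-∷-≢ [] [] (h refl)
  lcp-0^-snoc zero    (suc y) e≢0 f≢0 h = lcp-∷-≢ [] (0^ y ++ _) e≢0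
  lcp-0^-snoc (suc x) zero    e≢0 f≢0 h = lcp-∷-≢ (0^ x ++ _) [] (≢-sym f≢0)
  lcp-0^-snoc (suc x) (suc y) e≢0 f≢0 h =
    trans (lcp-∷-≡ 0 (0^ x ++ _) (0^ y ++ _)) (cong (0 ∷_) (lcp-0^-snoc x y e≢0 f≢0 (h ∘ cong suc)))

  lcs-snoc-≢ : ∀ u w {e f} → e ≢ f → lcs (u ++ [ e ]) (w ++ [ f ]) ≡ []
  lcs-snoc-≢ u w e≢f = cong reverse (begin
    lcp (reverse (u ++ [ _ ])) (reverse (w ++ [ _ ])) ≡⟨ cong₂ lcp (reverse-++ u [ _ ]) (reverse-++ w [ _ ]) ⟩
    lcp (_ ∷ reverse u) (_ ∷ reverse w)               ≡⟨ lcp-∷-≢ _ _ e≢f ⟩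
    []                                                ∎)
    where open ≡-Reasoning

  lcs-snoc-≡ : ∀ u w e → lcs (u ++ [ e ]) (w ++ [ e ]) ≡ lcs u w ++ [ e ]
  lcs-snoc-≡ u w e = begin
    reverse (lcp (reverse (u ++ [ e ])) (reverse (w ++ [ e ])))
      ≡⟨ cong reverse (cong₂ lcp (reverse-++ u [ e ]) (reverse-++ w [ e ])) ⟩
    reverse (lcp (e ∷ reverse u) (e ∷ reverse w))
      ≡⟨ cong reverse (lcp-∷-≡ e _ _) ⟩
    reverse (e ∷ lcp (reverse u) (reverse w))
      ≡⟨ unfold-reverse e (lcp (reverse u) (reverse w)) ⟩
    lcs u w ++ [ e ]
      ∎
    where open ≡-Reasoning

  lcs-0^ : ∀ x y → lcs (0^ x) (0^ y) ≡ 0^ (x ⊓ y)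
  lcs-0^ x y = begin
    reverse (lcp (reverse (0^ x)) (reverse (0^ y))) ≡⟨ cong reverse (cong₂ lcp (reverse-0^ x) (reverse-0^ y)) ⟩
    reverse (lcp (0^ x) (0^ y))                     ≡⟨ cong reverse (lcp-0^ x y) ⟩
    reverse (0^ (x ⊓ y))                            ≡⟨ reverse-0^ (x ⊓ y) ⟩
    0^ (x ⊓ y)                                      ∎
    where open ≡-Reasoning

  lcs-0^-snoc : ∀ x y e → lcs (0^ x ++ [ e ]) (0^ y ++ [ e ]) ≡ 0^ (x ⊓ y) ++ [ e ]
  lcs-0^-snoc x y e = trans (lcs-snoc-≡ (0^ x) (0^ y) e) (cong (_++ [ e ]) (lcs-0^ x y))

  Factor-suffix : ∀ u {w} → Factor (u ++ w) → Factor w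
  Factor-suffix u {w} (n , x , y , eq) = n , x ++ u , y ,
    trans (++-assoc x u (w ++ y)) (trans (cong (x ++_) (sym (++-assoc u w y))) eq)

  Factor-prefix : ∀ {w} u → Factor (w ++ u) → Factor w
  Factor-prefix {w} u (n , x , y , eq) = n , x , u ++ y , trans (cong (x ++_) (sym (++-assoc w u y))) eq

  φ*-++ : ∀ u w → φ* (u ++ w) ≡ φ* u ++ φ* w
  φ*-++ = concatMap-++ φ

  Factor-φ* : ∀ {w} → Factor w → Factor (φ* w)
  Factor-φ* {w} (n , x , y , eq) = suc n , φ* x , φ* y , (begin
    φ* x ++ φ* w ++ φ* y ≡⟨ cong (φ* x ++_) (φ*-++ w y) ⟨
    φ* x ++ φ* (w ++ y)  ≡⟨ φ*-++ x (w ++ y) ⟨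
    φ* (x ++ w ++ y)     ≡⟨ cong φ* eq ⟩
    uPrefix (suc n)      ∎)
    where open ≡-Reasoning

  Factor-φ-window : ∀ {a v c A L M c' R} → Factor (a ∷ v ++ [ c ]) →
    φ a ≡ A ++ L → φ c ≡ M ++ c' ∷ R → Factor (L ++ φ* v ++ M ++ [ c' ])
  Factor-φ-window {a} {v} {c} {A} {L} {M} {c'} {R} F φa φc =
    Factor-prefix R (Factor-suffix A (subst Factor image (Factor-φ* F)))
    where
    open ≡-Reasoning
    image : φ* (a ∷ v ++ [ c ]) ≡ A ++ (L ++ φ* v ++ M ++ [ c' ]) ++ R
    image = begin
      φ a ++ φ* (v ++ [ c ])                   ≡⟨ cong (φ a ++_) (φ*-++ v [ c ]) ⟩
      φ a ++ φ* v ++ φ c ++ []                 ≡⟨ cong₂ (λ P Q → P ++ φ* v ++ Q ++ []) φa φc ⟩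
      (A ++ L) ++ φ* v ++ (M ++ c' ∷ R) ++ [] ≡⟨ solve (++-monoid ℕ) ⟩
      A ++ (L ++ φ* v ++ M ++ [ c' ]) ++ R     ∎

  module Letters (m≥1 : m ≥ 1) (p≥1 : p ≥ 1) where

    m<m+p : m < m + p
    m<m+p = m<m+n m p≥1

    0<m+p : 0 < m + p
    0<m+p = ≤-trans (s≤s z≤n) m<m+p

    1<m+p : 1 < m + p
    1<m+p = +-mono-≤ m≥1 p≥1

    suc[m∸1]≡m : suc (m ∸ 1) ≡ m
    suc[m∸1]≡m = m+[n∸m]≡n m≥1

    suc[m+p∸1]≡m+p : suc (m + p ∸ 1) ≡ m + p
    suc[m+p∸1]≡m+p = m+[n∸m]≡n 0<m+p

    φ-below : ∀ a → suc a < m + p → φ a ≡ 0^ t (suc a) ++ [ suc a ]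
    φ-below a h with suc a <? m + p
    ... | yes _ = refl
    ... | no ¬h = ⊥-elim (¬h h)

    φ-top : ∀ a → ¬ suc a < m + p → φ a ≡ 0^ t (m + p) ++ [ m ]
    φ-top a ¬h with suc a <? m + p
    ... | yes h = ⊥-elim (¬h h)
    ... | no _  = refl

    ⊕1-cases : ∀ {a} → a < m + p →
      (suc a < m + p × a ⊕ 1 ≡ suc a) ⊎ (suc a ≡ m + p × a ⊕ 1 ≡ m)
    ⊕1-cases {a} a< with a + 1 <? m + p
    ... | yes h = inj₁ (subst (_< m + p) (+-comm a 1) h , +-comm a 1)
    ... | no ¬h = inj₂ (suc[a]≡m+p , wraps)
      where
      suc[a]≡m+p : suc a ≡ m + p
      suc[a]≡m+p = ≤-antisym a< (≮⇒≥ (¬h ∘ subst (_< m + p) (+-comm 1 a)))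
      wraps : m + ((a + 1 ∸ m) mod p) ≡ m
      wraps = begin
        m + ((a + 1 ∸ m) mod p)   ≡⟨ cong (λ k → m + ((k ∸ m) mod p)) (trans (+-comm a 1) suc[a]≡m+p) ⟩
        m + ((m + p ∸ m) mod p)   ≡⟨ cong (λ k → m + (k mod p)) (m+n∸m≡n m p) ⟩
        m + (p mod p)             ≡⟨ cong (m +_) (mod-self p) ⟩
        m + 0                     ≡⟨ +-identityʳ m ⟩
        m                         ∎
        where open ≡-Reasoning

    t⊕-1 : ∀ {a} → a < m + p → t⊕ a 1 ≡ t (suc a)
    t⊕-1 {a} a< with a + 1 ≤? m + p
    ... | yes _ = cong t (+-comm a 1)
    ... | no ¬h = ⊥-elim (¬h (subst (_≤ m + p) (+-comm 1 a) a<))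

    φ-shape : ∀ {a} → a < m + p → φ a ≡ 0^ t⊕ a 1 ++ [ a ⊕ 1 ]
    φ-shape {a} a< rewrite t⊕-1 a< with ⊕1-cases a<
    ... | inj₁ (h , e) rewrite e = φ-below a h
    ... | inj₂ (e , e') rewrite e' = trans (φ-top a (<-irrefl e)) (cong (λ k → 0^ t k ++ [ m ]) (sym e))

    ⊕1≢0 : ∀ {a} → a < m + p → a ⊕ 1 ≢ 0
    ⊕1≢0 a< with ⊕1-cases a<
    ... | inj₁ (_ , e) = λ e' → 0≢1+n (trans (sym e') e)
    ... | inj₂ (_ , e) = λ e' → <-irrefl (sym (trans (sym e) e')) m≥1

    ⊕1<m+p : ∀ {a} → a < m + p → a ⊕ 1 < m + p
    ⊕1<m+p a< with ⊕1-cases a<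
    ... | inj₁ (h , e) = subst (_< m + p) (sym e) h
    ... | inj₂ (_ , e) = subst (_< m + p) (sym e) m<m+p

    ⊕1-collision : ∀ {a b} → a < m + p → b < m + p → a ≢ b → a ⊕ 1 ≡ b ⊕ 1 → SpecialPair a b
    ⊕1-collision a< b< a≢b e with ⊕1-cases a< | ⊕1-cases b<
    ... | inj₁ (_ , ea) | inj₁ (_ , eb) = ⊥-elim (a≢b (suc-injective (trans (sym ea) (trans e eb))))
    ... | inj₁ (_ , ea) | inj₂ (qb , eb) = inj₁ (cong (_∸ 1) (trans (sym ea) (trans e eb)) , cong (_∸ 1) qb)
    ... | inj₂ (qa , ea) | inj₁ (_ , eb) = inj₂ (cong (_∸ 1) qa , cong (_∸ 1) (trans (sym eb) (trans (sym e) ea)))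
    ... | inj₂ (qa , _)  | inj₂ (qb , _) = ⊥-elim (a≢b (suc-injective (trans qa (sym qb))))

    φ-pred-m : φ (m ∸ 1) ≡ 0^ t m ++ [ m ]
    φ-pred-m = subst (λ k → φ (m ∸ 1) ≡ 0^ t k ++ [ k ]) suc[m∸1]≡m
                 (φ-below (m ∸ 1) (subst (_< m + p) (sym suc[m∸1]≡m) m<m+p))

    φ-pred-m+p : φ (m + p ∸ 1) ≡ 0^ t (m + p) ++ [ m ]
    φ-pred-m+p = φ-top (m + p ∸ 1) (<-irrefl suc[m+p∸1]≡m+p)

    t⊕-pred-m : t⊕ (m ∸ 1) 1 ≡ t m
    t⊕-pred-m = trans (t⊕-1 (subst (_≤ m + p) (sym suc[m∸1]≡m) (<⇒≤ m<m+p))) (cong t suc[m∸1]≡m)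

    t⊕-pred-m+p : t⊕ (m + p ∸ 1) 1 ≡ t (m + p)
    t⊕-pred-m+p = trans (t⊕-1 (≤-reflexive suc[m+p∸1]≡m+p)) (cong t suc[m+p∸1]≡m+p)

    φ-letters : ∀ k → All (_< m + p) (φ k)
    φ-letters k with suc k <? m + p
    ... | yes h = ++⁺ (replicate⁺ _ 0<m+p) (h ∷ [])
    ... | no _  = ++⁺ (replicate⁺ _ 0<m+p) (m<m+p ∷ [])

    uPrefix-letters : ∀ n → All (_< m + p) (uPrefix n)
    uPrefix-letters zero    = 0<m+p ∷ []
    uPrefix-letters (suc n) = concat⁺ (gmap⁺ (λ {k} _ → φ-letters k) (uPrefix-letters n))

    Factor-letters : ∀ {w} → Factor w → All (_< m + p) w
    Factor-letters {w} (n , x , y , eq) =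
      ++⁻ˡ w (++⁻ʳ x (subst (All (_< m + p)) (sym eq) (uPrefix-letters n)))

    Factor-ends< : ∀ {a v c} → Factor (a ∷ v ++ [ c ]) → a < m + p × c < m + p
    Factor-ends< {v = v} F with Factor-letters F
    ... | a< ∷ rest with ++⁻ʳ v rest
    ... | c< ∷ [] = a< , c<

  module Parry (N : NonSimpleParry m p t) where
    open NonSimpleParry N
    open Letters m≥1 p≥1 public

    periodic-from-m : t m ≡ t (m + p) → ∀ i → i ≥ m → t (i + p) ≡ t i
    periodic-from-m e i i≥m with m ≟ i
    ... | yes refl = sym e
    ... | no  m≢i  = periodic i (≤∧≢⇒< i≥m m≢i)

    -- If t_m = t_{m+p}, t is periodic from m − 1 on: this contradicts minimality of m, or
    -- admissibility at shift p when m = 1.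
    t[m]≢t[m+p] : t m ≢ t (m + p)
    t[m]≢t[m+p] e with m ≟ 1
    ... | yes refl = periodic⇒¬ShiftLexLess {t} {p} shift≡t (admissible p p≥1)
      where
      shift≡t : ∀ j → t (p + suc j) ≡ t (suc j)
      shift≡t j = trans (cong t (+-comm p (suc j))) (periodic-from-m e (suc j) (s≤s z≤n))
    ... | no  m≢1  = <⇒≱ (subst (m ∸ 1 <_) suc[m∸1]≡m (n<1+n (m ∸ 1))) m≤m∸1
      where
      m≤m∸1 : m ≤ m ∸ 1
      m≤m∸1 = proj₁ (minimal (m ∸ 1) p (∸-monoˡ-≤ 1 (≤∧≢⇒< m≥1 (≢-sym m≢1))) p≥1
                       (λ i i>m∸1 → periodic-from-m e i (subst (_≤ i) suc[m∸1]≡m i>m∸1)))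

    ⊕1-injective : ∀ {c d} → c < m + p → d < m + p → c ⊕ 1 ≡ d ⊕ 1 → t⊕ c 1 ≡ t⊕ d 1 → c ≡ d
    ⊕1-injective {c} {d} c< d< e e' with c ≟ d
    ... | yes c≡d = c≡d
    ... | no  c≢d with ⊕1-collision c< d< c≢d e
    ...   | inj₁ (refl , refl) = ⊥-elim (t[m]≢t[m+p] (trans (sym t⊕-pred-m) (trans e' t⊕-pred-m+p)))
    ...   | inj₂ (refl , refl) = ⊥-elim (t[m]≢t[m+p] (trans (sym t⊕-pred-m) (trans (sym e') t⊕-pred-m+p)))

    φ-0 : ∃ λ r → φ 0 ≡ 0 ∷ r
    φ-0 = starts-with-0 t₁≥1 (φ-below 0 1<m+p)
      where
      starts-with-0 : ∀ {k u} → k ≥ 1 → φ 0 ≡ 0^ k ++ u → ∃ λ r → φ 0 ≡ 0 ∷ r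
      starts-with-0 {suc _} _ e = _ , e

    uPrefix-head : ∀ n → ∃ λ r → uPrefix n ≡ 0 ∷ r
    uPrefix-head zero    = [] , refl
    uPrefix-head (suc n) with uPrefix-head n | φ-0
    ... | r , e | r' , e' = r' ++ φ* r , trans (cong φ* e) (cong (_++ φ* r) e')

    -- u_β starts with 0, so every other letter occurrence has a left neighbour.
    Factor-extendˡ : ∀ {s w} → s ≢ 0 → Factor (s ∷ w) → ∃ λ l → Factor (l ∷ s ∷ w)
    Factor-extendˡ {s} {w} s≢0 (n , x , y , eq) with reverseView x
    ... | []           = ⊥-elim (s≢0 (∷-injectiveˡ (trans eq (proj₂ (uPrefix-head n)))))
    ... | x₀ ∶ _ ∶ʳ l  = l , n , x₀ , y , trans (sym (++-assoc x₀ [ l ] _)) eq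

    m∸1≢0 : t m < t (m + p) → m ∸ 1 ≢ 0
    m∸1≢0 lt m∸1≡0 = <⇒≱ lt (subst (λ k → t (k + p) ≤ t k) 1≡m t[1+p]≤t₁)
      where
      1≡m : 1 ≡ m
      1≡m = trans (cong suc (sym m∸1≡0)) suc[m∸1]≡m
      t[1+p]≤t₁ : t (1 + p) ≤ t 1
      t[1+p]≤t₁ = subst (λ k → t k ≤ t 1) (+-comm p 1) (ShiftLexLess⇒≤ {t} (admissible p p≥1))

    m+p∸1≢0 : m + p ∸ 1 ≢ 0
    m+p∸1≢0 e = <-irrefl (trans (cong suc (sym e)) suc[m+p∸1]≡m+p) 1<m+p

    MinimalImage : ℕ → Set
    MinimalImage s = s ≢ 0 × φ s ≡ 0^ tmin ++ [ m ]

    LongerImage : ℕ → Set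
    LongerImage s = ∃ λ k → tmin < k × φ s ≡ 0^ k ++ [ m ]

    pred-images : (MinimalImage (m ∸ 1) × LongerImage (m + p ∸ 1))
                ⊎ (LongerImage (m ∸ 1) × MinimalImage (m + p ∸ 1))
    pred-images with <-cmp (t m) (t (m + p))
    ... | tri< lt _ _ =
      inj₁ ((m∸1≢0 lt , subst (λ k → φ (m ∸ 1) ≡ 0^ k ++ [ m ]) (sym tmin≡t[m]) φ-pred-m) ,
            t (m + p) , subst (_< t (m + p)) (sym tmin≡t[m]) lt , φ-pred-m+p)
      where
      tmin≡t[m] : tmin ≡ t m
      tmin≡t[m] = m≤n⇒m⊓n≡m (<⇒≤ lt)
    ... | tri≈ _ e _ = ⊥-elim (t[m]≢t[m+p] e)
    ... | tri> _ _ gt =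
      inj₂ ((t m , subst (_< t m) (sym tmin≡t[m+p]) gt , φ-pred-m) ,
            m+p∸1≢0 , subst (λ k → φ (m + p ∸ 1) ≡ 0^ k ++ [ m ]) (sym tmin≡t[m+p]) φ-pred-m+p)
      where
      tmin≡t[m+p] : tmin ≡ t (m + p)
      tmin≡t[m+p] = m≥n⇒m⊓n≡n (<⇒≤ gt)

    special-images : ∀ {a b} → SpecialPair a b →
      (MinimalImage a × LongerImage b) ⊎ (LongerImage a × MinimalImage b)
    special-images (inj₁ (refl , refl)) = pred-images
    special-images (inj₂ (refl , refl)) = Sum.swap (Sum.map Product.swap Product.swap pred-images)

    fL-images-ending-in-m : ∀ {a b x y} → φ a ≡ 0^ x ++ [ m ] → φ b ≡ 0^ y ++ [ m ] →
      fL a b ≡ 0^ (x ⊓ y) ++ [ m ]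
    fL-images-ending-in-m {x = x} {y} φa φb = trans (cong₂ lcs φa φb) (lcs-0^-snoc x y m)

    fL-special : ∀ {a b} → SpecialPair a b → fL a b ≡ 0^ tmin ++ [ m ]
    fL-special sp with special-images sp
    ... | inj₁ ((_ , φa) , _ , tmin<k , φb) =
      trans (fL-images-ending-in-m φa φb) (cong (λ j → 0^ j ++ [ m ]) (m≤n⇒m⊓n≡m (<⇒≤ tmin<k)))
    ... | inj₂ ((_ , tmin<k , φa) , _ , φb) =
      trans (fL-images-ending-in-m φa φb) (cong (λ j → 0^ j ++ [ m ]) (m≥n⇒m⊓n≡n (<⇒≤ tmin<k)))

    window-⊕1 : ∀ {a v c M c' R} → Factor (a ∷ v ++ [ c ]) → φ c ≡ M ++ c' ∷ R →
      Factor ((a ⊕ 1) ∷ φ* v ++ M ++ [ c' ])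
    window-⊕1 F = Factor-φ-window F (φ-shape (proj₁ (Factor-ends< F)))

    window-longer : ∀ {a v c M c' R} → LongerImage a → Factor (a ∷ v ++ [ c ]) → φ c ≡ M ++ c' ∷ R →
      Factor (0 ∷ (0^ tmin ++ [ m ]) ++ φ* v ++ M ++ [ c' ])
    window-longer {a} (k , tmin<k , φa) F = Factor-φ-window F (begin
      φ a                                         ≡⟨ φa ⟩
      0^ k ++ [ m ]                               ≡⟨ cong (λ j → 0^ j ++ [ m ]) (m∸n+n≡m tmin<k) ⟨
      0^ (k ∸ suc tmin + suc tmin) ++ [ m ]       ≡⟨ 0^-+-snoc (k ∸ suc tmin) (suc tmin) m ⟩
      0^ (k ∸ suc tmin) ++ 0 ∷ 0^ tmin ++ [ m ]   ∎)
      where open ≡-Reasoning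

    window-minimal : ∀ {z a v c M c' R} →
      (∀ z' → z' ≢ 0 → z' < m + p → Factor (z' ∷ 0^ tmin ++ [ m ]) → z' ≡ z) →
      MinimalImage a → Factor (a ∷ v ++ [ c ]) → φ c ≡ M ++ c' ∷ R →
      Factor (z ∷ (0^ tmin ++ [ m ]) ++ φ* v ++ M ++ [ c' ])
    window-minimal {z} {a} {v} {c} {M} {c'} z-unique (a≢0 , φa) F φc with Factor-extendˡ a≢0 F
    ... | l , F' = subst (λ y → Factor (y ∷ _)) (z-unique (l ⊕ 1) (⊕1≢0 l<) (⊕1<m+p l<) l⊕1-before) G
      where
      l< : l < m + p
      l< = proj₁ (Factor-ends< {v = a ∷ v} F')
      G : Factor ((l ⊕ 1) ∷ (0^ tmin ++ [ m ]) ++ φ* v ++ M ++ [ c' ])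
      G = subst (λ W → Factor ((l ⊕ 1) ∷ W))
            (trans (++-assoc (φ a) (φ* v) _) (cong (_++ φ* v ++ M ++ [ c' ]) φa))
            (window-⊕1 {v = a ∷ v} F' φc)
      l⊕1-before : Factor ((l ⊕ 1) ∷ 0^ tmin ++ [ m ])
      l⊕1-before = Factor-prefix {(l ⊕ 1) ∷ 0^ tmin ++ [ m ]} (φ* v ++ M ++ [ c' ]) G

    module Image {a c b d : ℕ} {v : Word} (a≢b : a ≢ b) (c≢d : c ≢ d)
                 (Fac : Factor (a ∷ v ++ [ c ])) (Fbd : Factor (b ∷ v ++ [ d ])) where

      a< : a < m + p
      a< = proj₁ (Factor-ends< Fac)

      c< : c < m + p
      c< = proj₂ (Factor-ends< Fac)

      b< : b < m + p
      b< = proj₁ (Factor-ends< Fbd)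

      d< : d < m + p
      d< = proj₂ (Factor-ends< Fbd)

      μ c' d' : ℕ
      μ  = t⊕ c 1 ⊓ t⊕ d 1
      c' = firstLetter (0^ (t⊕ c 1 ∸ μ) ++ [ c ⊕ 1 ])
      d' = firstLetter (0^ (t⊕ d 1 ∸ μ) ++ [ d ⊕ 1 ])

      φc-φd-differ : t⊕ c 1 ≡ t⊕ d 1 → c ⊕ 1 ≢ d ⊕ 1
      φc-φd-differ e' e = c≢d (⊕1-injective c< d< e e')

      fR-≡ : fR c d ≡ 0^ μ
      fR-≡ = trans (cong₂ lcp (φ-shape c<) (φ-shape d<))
                   (lcp-0^-snoc (t⊕ c 1) (t⊕ d 1) (⊕1≢0 c<) (⊕1≢0 d<) φc-φd-differ)

      c'≢d' : c' ≢ d'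
      c'≢d' = firstLetter-0^-∸⊓-≢ (t⊕ c 1) (t⊕ d 1) (⊕1≢0 c<) (⊕1≢0 d<) φc-φd-differ

      φc-split : ∃ λ R → φ c ≡ 0^ μ ++ c' ∷ R
      φc-split = map₂ (trans (φ-shape c<)) (0^-snoc-split μ (t⊕ c 1) (c ⊕ 1) (m⊓n≤m _ _))

      φd-split : ∃ λ R → φ d ≡ 0^ μ ++ d' ∷ R
      φd-split = map₂ (trans (φ-shape d<)) (0^-snoc-split μ (t⊕ d 1) (d ⊕ 1) (m⊓n≤n _ _))

      fL-nonspecial : ¬ SpecialPair a b → fL a b ≡ []
      fL-nonspecial ns = trans (cong₂ lcs (φ-shape a<) (φ-shape b<))
                               (lcs-snoc-≢ (0^ t⊕ a 1) (0^ t⊕ b 1) (ns ∘ ⊕1-collision a< b< a≢b))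

      widen : ∀ {X q L} → fL a b ≡ L → Factor (X ∷ L ++ φ* v ++ 0^ μ ++ [ q ]) →
        Factor (X ∷ fImage a c b d v ++ [ q ])
      widen {X} {q} {L} fL≡L = subst (λ W → Factor (X ∷ W)) (begin
        L ++ φ* v ++ 0^ μ ++ [ q ]         ≡⟨ solve (++-monoid ℕ) ⟩
        (L ++ φ* v ++ 0^ μ) ++ [ q ]       ≡⟨ cong₂ (λ L' R' → (L' ++ φ* v ++ R') ++ [ q ]) (sym fL≡L) (sym fR-≡) ⟩
        fImage a c b d v ++ [ q ]           ∎)
        where open ≡-Reasoning

      image-nonspecial : ¬ SpecialPair a b → Bispecial (a ⊕ 1) c' (b ⊕ 1) d' (fImage a c b d v)
      image-nonspecial ns =
        ns ∘ ⊕1-collision a< b< a≢b , c'≢d' ,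
        widen (fL-nonspecial ns) (window-⊕1 Fac (proj₂ φc-split)) ,
        widen (fL-nonspecial ns) (window-⊕1 Fbd (proj₂ φd-split))

      image-special : ∀ {z} → z ≢ 0 →
        (∀ z' → z' ≢ 0 → z' < m + p → Factor (z' ∷ 0^ tmin ++ [ m ]) → z' ≡ z) →
        SpecialPair a b →
        Bispecial 0 c' z d' (fImage a c b d v) ⊎ Bispecial z c' 0 d' (fImage a c b d v)
      image-special z≢0 z-unique sp with special-images sp
      ... | inj₁ (min-a , longer-b) = inj₂ (z≢0 , c'≢d' ,
              widen (fL-special sp) (window-minimal z-unique min-a Fac (proj₂ φc-split)) ,
              widen (fL-special sp) (window-longer longer-b Fbd (proj₂ φd-split)))
      ... | inj₂ (longer-a , min-b) = inj₁ (≢-sym z≢0 , c'≢d' ,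
              widen (fL-special sp) (window-longer longer-a Fac (proj₂ φc-split)) ,
              widen (fL-special sp) (window-minimal z-unique min-b Fbd (proj₂ φd-split)))

lemma4p6 : (m p : ℕ) (t : ℕ → ℕ) → NonSimpleParry m p t → t 1 ≥ 2 →
    let open Setup m p t in
    (z : ℕ) → z ≢ 0 → z < m + p → Factor (z ∷ replicate tmin 0 ++ [ m ]) →
    (∀ z' → z' ≢ 0 → z' < m + p → Factor (z' ∷ replicate tmin 0 ++ [ m ]) → z' ≡ z) →
    (a b c d : ℕ) (v : List ℕ) → Bispecial a c b d v →
    let μ  = t⊕ c 1 ⊓ t⊕ d 1
        c' = firstLetter (replicate (t⊕ c 1 ∸ μ) 0 ++ [ c ⊕ 1 ])
        d' = firstLetter (replicate (t⊕ d 1 ∸ μ) 0 ++ [ d ⊕ 1 ])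
        w  = fImage a c b d v
    in (SpecialPair a b → fL a b ≡ replicate tmin 0 ++ [ m ])
       × (¬ SpecialPair a b → fL a b ≡ [])
       × fR c d ≡ replicate μ 0
       × (SpecialPair a b → Bispecial 0 c' z d' w ⊎ Bispecial z c' 0 d' w)
       × (¬ SpecialPair a b → Bispecial (a ⊕ 1) c' (b ⊕ 1) d' w)
lemma4p6 m p t N _ z z≢0 _ _ z-unique a b c d v (a≢b , c≢d , Fac , Fbd) =
  fL-special , fL-nonspecial , fR-≡ , image-special z≢0 z-unique , image-nonspecial
  where
  open Bispecials m p t
  open Parry N
  open Image a≢b c≢d Fac Fbd
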